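{- Let $m_1,\dots,m_n,b$ be positive integers and let $m$ be a positive integer with $[m_1,\dots,m_n]\mid m$. Then \[ \sum_{d_1\mid m_1,\dots,d_n\mid m_n}E(b;d_1,\dots,d_n)=J(b;m_1,\dots,m_n), \] where \[ E(b;r_1,\dots,r_n)=\frac{1}{m}\sum_{j=1}^{m}C_{r_1}(j)\cdots C_{r_n}(j)\,e^{2\pi i bj/m} \] for positive integers $r_1,\dots,r_n$ with $[r_1,\dots,r_n]\mid m$, and \[ J(b;m_1,\dots,m_n)=\begin{cases}\dfrac{m_1\cdots m_n}{[m_1,\dots,m_n]}, & \text{if } \dfrac{m}{[m_1,\dots,m_n]}\mid b,\\[2mm] 0,&\text{otherwise.}\end{cases} \]
   Context: $[\cdot,\dots,\cdot]$ denotes lcm; sums over $d_i\mid m_i$ are over positive divisors. For integers $a$ and $r\ge1$, the Ramanujan sum is $C_r(a)=\sum_{1\le j\le r,\ (j,r)=1}e^{2\pi i ja/r}$. -}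

module Defs where

open import Level using (Level)
open import Data.Nat as ℕ using (ℕ; zero; suc; _/_)
open import Data.Nat.Divisibility using (_∣_; _∣?_)
open import Data.Nat.Coprimality using (coprime?)
open import Data.Nat.LCM using (lcm)
open import Data.List as List using (List; []; _∷_; upTo; filter; map; concatMap)
open import Data.Vec as Vec using (Vec; []; _∷_)
open import Relation.Nullary using (yes; no)
open import Algebra.Bundles using (CommutativeRing)

lcmV : ∀ {n} → Vec ℕ n → ℕ
lcmV = Vec.foldr _ lcm 1

prodV : ∀ {n} → Vec ℕ n → ℕ
prodV = Vec.foldr _ ℕ._*_ 1

-- quotient a / r for r > 0 (only used when r ∣ a and r > 0)
quot : ℕ → ℕ → ℕ
quot a zero    = 0
quot a (suc r) = a / suc r

oneTo : ℕ → List ℕ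
oneTo r = map suc (upTo r)

divisors : ℕ → List ℕ
divisors r = filter (_∣? r) (oneTo r)

tuples : ∀ {n} → Vec (List ℕ) n → List (Vec ℕ n)
tuples []         = [] ∷ []
tuples (ds ∷ dss) = concatMap (λ d → map (d ∷_) (tuples dss)) ds

-- Operations in a commutative ring R with a chosen element ζ, which will be a
-- primitive m-th root of unity playing the role of e^{2πi/m}.
module Cyclo {c ℓ : Level} (R : CommutativeRing c ℓ) (ζ : CommutativeRing.Carrier R) (m : ℕ) where
  open CommutativeRing R

  pow : Carrier → ℕ → Carrier
  pow x zero    = 1#
  pow x (suc k) = x * pow x k

  cast : ℕ → Carrier
  cast zero    = 0#
  cast (suc k) = 1# + cast k

  sumL : List Carrier → Carrier
  sumL = List.foldr _+_ 0#

  prodVR : ∀ {n} → Vec Carrier n → Carrier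
  prodVR = Vec.foldr _ _*_ 1#

  -- e(k / r) = e^{2πi k / r}, for r ∣ m, r > 0:  equal to ζ^{k·(m/r)}
  e : ℕ → ℕ → Carrier
  e k r = pow ζ (k ℕ.* quot m r)

  C : ℕ → ℕ → Carrier
  C r a = sumL (map (λ j → e (j ℕ.* a) r) (filter (λ j → coprime? j r) (oneTo r)))

  -- E(b; r₁,…,rₙ) = (1/m) Σ_{j=1}^{m} C_{r₁}(j)⋯C_{rₙ}(j) e^{2πi b j / m},
  -- where minv stands for 1/m
  E : (minv : Carrier) → ℕ → ∀ {n} → Vec ℕ n → Carrier
  E minv b rs = minv * sumL (map (λ j → prodVR (Vec.map (λ r → C r j) rs) * e (b ℕ.* j) m) (oneTo m))

  J : ℕ → ∀ {n} → Vec ℕ n → Carrier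
  J b ms with quot m (lcmV ms) ∣? b
  ... | yes _ = cast (quot (prodV ms) (lcmV ms))
  ... | no  _ = 0#

  LHS : (minv : Carrier) → ℕ → ∀ {n} → Vec ℕ n → Carrier
  LHS minv b ms = sumL (map (E minv b) (tuples (Vec.map divisors ms)))

-- Let ζ be a primitive m-th root of unity, e(x / r) = ζ^(x m / r), and r ∣ m.  Grouping
-- t ∈ [1, r] by the reduced denominator r / gcd(t, r) of t / r turns Σ_{d ∣ r} C_d(j) into
-- Σ_{t=1}^{r} e(tj / r), which is r if r ∣ j and a vanishing geometric sum otherwise (this is
-- where the absence of zero divisors is used).  Expanding the sum over divisor tuples as a
-- product of such divisor sums, the summand of E becomes m₁⋯mₙ · [L ∣ j] with L = [m₁,…,mₙ];
-- averaging this against e(bj / m) over j = L t is once more such a sum, now of e(tb / (m/L))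
-- over t ≤ m / L, and so picks out m / L ∣ b.

module Submission where

open import Defs
open import Level using (Level)
open import Data.Bool using (Bool; true; false)
open import Data.List as List using (List; []; _∷_; _++_; map; filter; upTo)
import Data.List.Properties as List
open import Data.Nat as ℕ using (ℕ; zero; suc; _<_; _≤_; z≤n; s≤s; z<s; >-nonZero)
import Data.Nat.Properties as ℕₚ
open import Data.Nat.Coprimality using (Coprime; coprime?; coprime⇒gcd≡1; gcd≡1⇒coprime)
open import Data.Nat.DivMod using (_%_; _/_; m*n/n≡m; n/1≡n; m%n<n; m≡m%n+[m/n]*n)
open import Data.Nat.Divisibility
  using (_∣_; _∣?_; divides; ∣-trans; ∣-refl; 1∣_; m∣m*n; n∣m*n; ∣⇒≤; ∣m+n∣m⇒∣n;
         *-monoʳ-∣; *-monoˡ-∣; *-cancelʳ-∣; m%n≡0⇒n∣m)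
open import Data.Nat.GCD using (gcd; gcd[m,n]∣m; gcd[m,n]∣n; gcd[m,n]≢0; c*gcd[m,n]≡gcd[cm,cn])
open import Data.Nat.LCM using (lcm; m∣lcm[m,n]; n∣lcm[m,n]; lcm-least; gcd*lcm)
open import Data.Nat.Tactic.RingSolver using (solve-∀)
open import Data.Sum using (_⊎_; inj₁; inj₂)
open import Data.Vec as Vec using (Vec; []; _∷_)
open import Data.Vec.Relation.Unary.All using (All; []; _∷_)
open import Function.Base using (_∘_)
open import Function.Bundles using (_⇔_; mk⇔)
open import Relation.Nullary using (¬_; Dec; yes; no; does; contradiction)
open import Relation.Nullary.Decidable using (does-⇔)
open import Relation.Unary using (Pred; Decidable)
open import Relation.Binary.PropositionalEquality as ≡ using (_≡_; _≢_)
open import Algebra.Bundles using (CommutativeRing)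

module _ where
  open import Data.Nat using (_*_)
  open ≡ using (refl; sym; trans; cong; subst)
  open ≡.≡-Reasoning

  ∣-positive : ∀ {d n} → 0 < n → d ∣ n → 0 < d
  ∣-positive {zero}  n>0 (divides q eq) = contradiction (trans eq (ℕₚ.*-zeroʳ q)) (ℕₚ.n>0⇒n≢0 n>0)
  ∣-positive {suc d} _   _              = z<s

  quot-exact : ∀ {a q r} → 0 < r → a ≡ q * r → quot a r ≡ q
  quot-exact {q = q} {suc r} _ refl = m*n/n≡m q (suc r)

  quot*≡ : ∀ {a r} → 0 < r → r ∣ a → quot a r * r ≡ a
  quot*≡ {r = r} r>0 (divides q eq) = trans (cong (_* r) (quot-exact {q = q} r>0 eq)) (sym eq)

  *quot≡ : ∀ {a r} → 0 < r → r ∣ a → r * quot a r ≡ a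
  *quot≡ {r = r} r>0 r∣a = trans (ℕₚ.*-comm r _) (quot*≡ r>0 r∣a)

  quot∣ : ∀ {a r} → 0 < r → r ∣ a → quot a r ∣ a
  quot∣ {r = r} r>0 r∣a = divides r (sym (*quot≡ r>0 r∣a))

  lcmV∣prodV : ∀ {n} (ms : Vec ℕ n) → lcmV ms ∣ prodV ms
  lcmV∣prodV []       = ∣-refl
  lcmV∣prodV (r ∷ rs) =
    ∣-trans (divides (gcd r (lcmV rs)) (sym (gcd*lcm r (lcmV rs)))) (*-monoʳ-∣ r (lcmV∣prodV rs))

  reducedDenom : ℕ → ℕ → ℕ
  reducedDenom t r = quot r (gcd t r)

  0<gcd : ∀ t {r} → 0 < r → 0 < gcd t r
  0<gcd t {r} r>0 = ℕₚ.n≢0⇒n>0 (gcd[m,n]≢0 t r (inj₂ (ℕₚ.n>0⇒n≢0 r>0)))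

  reducedDenom*gcd : ∀ t {r} → 0 < r → reducedDenom t r * gcd t r ≡ r
  reducedDenom*gcd t {r} r>0 = quot*≡ (0<gcd t r>0) (gcd[m,n]∣n t r)

  reducedDenom∣ : ∀ t {r} → 0 < r → reducedDenom t r ∣ r
  reducedDenom∣ t {r} r>0 =
    divides (gcd t r) (sym (trans (ℕₚ.*-comm (gcd t r) _) (reducedDenom*gcd t r>0)))

  reducedDenom≤ : ∀ t {r} → 0 < r → reducedDenom t r ≤ r
  reducedDenom≤ t {suc r} r>0 = ∣⇒≤ (reducedDenom∣ t r>0)

  reducedDenom-* : ∀ g k {d} → 0 < g → 0 < d → reducedDenom (g * k) (g * d) ≡ reducedDenom k d
  reducedDenom-* g k {d} g>0 d>0 = begin
    quot (g * d) (gcd (g * k) (g * d)) ≡⟨ cong (quot (g * d)) (sym (c*gcd[m,n]≡gcd[cm,cn] g k d)) ⟩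
    quot (g * d) (g * gcd k d)         ≡⟨ quot-exact (ℕₚ.*-mono-< g>0 (0<gcd k d>0)) g*d≡ ⟩
    reducedDenom k d                   ∎
    where
    rearrange : ∀ g x y → g * (x * y) ≡ x * (g * y)
    rearrange = solve-∀
    g*d≡ : g * d ≡ reducedDenom k d * (g * gcd k d)
    g*d≡ = trans (cong (g *_) (sym (reducedDenom*gcd k d>0))) (rearrange g (reducedDenom k d) (gcd k d))

  reducedDenom≡⇒∣ : ∀ {g d} t → 0 < g * d → reducedDenom t (g * d) ≡ d → g ∣ t
  reducedDenom≡⇒∣ {g} {d} t gd>0 rd≡d = subst (_∣ t) gcd≡g (gcd[m,n]∣m t (g * d))
    where
    gcd≡g : gcd t (g * d) ≡ g
    gcd≡g = ℕₚ.*-cancelʳ-≡ _ g d {{>-nonZero (∣-positive gd>0 (n∣m*n g))}} (begin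
      gcd t (g * d) * d                        ≡⟨ cong (gcd t (g * d) *_) (sym rd≡d) ⟩
      gcd t (g * d) * reducedDenom t (g * d)   ≡⟨ ℕₚ.*-comm (gcd t (g * d)) _ ⟩
      reducedDenom t (g * d) * gcd t (g * d)   ≡⟨ reducedDenom*gcd t gd>0 ⟩
      g * d                                    ∎)

  reducedDenom≡⇔coprime : ∀ k {d} → 0 < d → reducedDenom k d ≡ d ⇔ Coprime k d
  reducedDenom≡⇔coprime k {d} d>0 = mk⇔ to from
    where
    to : reducedDenom k d ≡ d → Coprime k d
    to rd≡d = gcd≡1⇒coprime (ℕₚ.*-cancelˡ-≡ (gcd k d) 1 d {{>-nonZero d>0}} (begin
      d * gcd k d                  ≡⟨ cong (_* gcd k d) (sym rd≡d) ⟩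
      reducedDenom k d * gcd k d   ≡⟨ reducedDenom*gcd k d>0 ⟩
      d                            ≡⟨ ℕₚ.*-identityʳ d ⟨
      d * 1                        ∎))
    from : Coprime k d → reducedDenom k d ≡ d
    from coprime rewrite coprime⇒gcd≡1 coprime = n/1≡n d

module _ {c ℓ : Level} (R : CommutativeRing c ℓ) (ζ : CommutativeRing.Carrier R) (m : ℕ) where
  open CommutativeRing R
  open Cyclo R ζ m
  open import Algebra.Properties.Ring ring using (x∙y⁻¹≈ε⇒x≈y; x≈y⇒x∙y⁻¹≈ε; [y-z]x≈yx-zx; +-cancelʳ)
  open import Algebra.Properties.Semiring.Exp semiring using (_^_; ^-homo-*; ^-assocʳ)
  open import Algebra.Properties.Semiring.Mult semiring using (_×_; ×1-homo-*)
  open import Algebra.Properties.CommutativeSemigroup +-commutativeSemigroup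
    using () renaming (interchange to +-interchange)
  open import Relation.Binary.Reasoning.Setoid setoid

  pow≡^ : ∀ x k → pow x k ≡ x ^ k
  pow≡^ x zero    = ≡.refl
  pow≡^ x (suc k) = ≡.cong (x *_) (pow≡^ x k)

  cast≡× : ∀ k → cast k ≡ k × 1#
  cast≡× zero    = ≡.refl
  cast≡× (suc k) = ≡.cong (1# +_) (cast≡× k)

  pow-+ : ∀ x a b → pow x (a ℕ.+ b) ≈ pow x a * pow x b
  pow-+ x a b rewrite pow≡^ x (a ℕ.+ b) | pow≡^ x a | pow≡^ x b = ^-homo-* x a b

  pow-* : ∀ x a b → pow x (a ℕ.* b) ≈ pow (pow x a) b
  pow-* x a b rewrite pow≡^ x (a ℕ.* b) | pow≡^ (pow x a) b | pow≡^ x a = sym (^-assocʳ x a b)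

  cast-* : ∀ a b → cast (a ℕ.* b) ≈ cast a * cast b
  cast-* a b rewrite cast≡× (a ℕ.* b) | cast≡× a | cast≡× b = ×1-homo-* a b

  sumTo : ℕ → (ℕ → Carrier) → Carrier
  sumTo zero    f = 0#
  sumTo (suc r) f = sumTo r f + f (suc r)

  sumTo-cong : ∀ r {f g} → (∀ k → f k ≈ g k) → sumTo r f ≈ sumTo r g
  sumTo-cong zero    f≈g = refl
  sumTo-cong (suc r) f≈g = +-cong (sumTo-cong r f≈g) (f≈g (suc r))

  sumTo-zero : ∀ r f → (∀ k → 1 ≤ k → k ≤ r → f k ≈ 0#) → sumTo r f ≈ 0#
  sumTo-zero zero    f f≈0 = refl
  sumTo-zero (suc r) f f≈0 = begin
    sumTo r f + f (suc r) ≈⟨ +-cong (sumTo-zero r f λ k 1≤k k≤r → f≈0 k 1≤k (ℕₚ.m≤n⇒m≤1+n k≤r))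
                                    (f≈0 (suc r) (s≤s z≤n) ℕₚ.≤-refl) ⟩
    0# + 0#               ≈⟨ +-identityʳ 0# ⟩
    0#                    ∎

  sumTo-distrib-+ : ∀ r f g → sumTo r (λ k → f k + g k) ≈ sumTo r f + sumTo r g
  sumTo-distrib-+ zero    f g = sym (+-identityʳ 0#)
  sumTo-distrib-+ (suc r) f g = trans (+-congʳ (sumTo-distrib-+ r f g)) (+-interchange _ _ _ _)

  *-distribˡ-sumTo : ∀ r x f → x * sumTo r f ≈ sumTo r (λ k → x * f k)
  *-distribˡ-sumTo zero    x f = zeroʳ x
  *-distribˡ-sumTo (suc r) x f = trans (distribˡ x _ _) (+-congʳ (*-distribˡ-sumTo r x f))

  sumTo-comm : ∀ r s (f : ℕ → ℕ → Carrier) →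
    sumTo r (λ i → sumTo s (f i)) ≈ sumTo s (λ j → sumTo r (λ i → f i j))
  sumTo-comm zero    s f = sym (sumTo-zero s _ (λ _ _ _ → refl))
  sumTo-comm (suc r) s f = trans (+-congʳ (sumTo-comm r s f)) (sym (sumTo-distrib-+ s _ _))

  sumTo-single : ∀ r f x → 1 ≤ x → x ≤ r → (∀ k → 1 ≤ k → k ≤ r → k ≢ x → f k ≈ 0#) →
    sumTo r f ≈ f x
  sumTo-single zero    f x 1≤x x≤0 _ = contradiction (ℕₚ.n≤0⇒n≡0 x≤0) (ℕₚ.n>0⇒n≢0 1≤x)
  sumTo-single (suc r) f x 1≤x x≤1+r f≈0 with x ℕₚ.≟ suc r
  ... | yes ≡.refl = trans (+-congʳ (sumTo-zero r f λ k 1≤k k≤r →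
                       f≈0 k 1≤k (ℕₚ.m≤n⇒m≤1+n k≤r) (ℕₚ.<⇒≢ (s≤s k≤r)))) (+-identityˡ _)
  ... | no x≢1+r = trans (+-cong (sumTo-single r f x 1≤x (ℕₚ.≤-pred (ℕₚ.≤∧≢⇒< x≤1+r x≢1+r))
                                    λ k 1≤k k≤r → f≈0 k 1≤k (ℕₚ.m≤n⇒m≤1+n k≤r))
                               (f≈0 (suc r) (s≤s z≤n) ℕₚ.≤-refl (x≢1+r ∘ ≡.sym)))
                         (+-identityʳ _)

  sumTo-+ : ∀ a b f → sumTo (a ℕ.+ b) f ≈ sumTo a f + sumTo b (λ i → f (a ℕ.+ i))
  sumTo-+ a zero    f rewrite ℕₚ.+-identityʳ a = sym (+-identityʳ _)
  sumTo-+ a (suc b) f rewrite ℕₚ.+-suc a b = trans (+-congʳ (sumTo-+ a b f)) (+-assoc _ _ _)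

  sumTo-suc : ∀ s f → sumTo (suc s) f ≈ f 1 + sumTo s (λ t → f (suc t))
  sumTo-suc zero    f = trans (+-identityˡ _) (sym (+-identityʳ _))
  sumTo-suc (suc s) f = trans (+-congʳ (sumTo-suc s f)) (+-assoc _ _ _)

  sumTo-const : ∀ s → sumTo s (λ _ → 1#) ≈ cast s
  sumTo-const zero    = refl
  sumTo-const (suc s) = trans (+-congʳ (sumTo-const s)) (+-comm _ _)

  sumTo-multiples : ∀ g s h → 0 < g → (∀ t → ¬ g ∣ t → h t ≈ 0#) →
    sumTo (g ℕ.* s) h ≈ sumTo s (λ k → h (g ℕ.* k))
  sumTo-multiples g zero    h g>0 h≈0 rewrite ℕₚ.*-zeroʳ g = refl
  sumTo-multiples g (suc s) h g>0 h≈0 = begin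
    sumTo (g ℕ.* suc s) h                              ≡⟨ ≡.cong (λ n → sumTo n h) g[1+s]≡gs+g ⟩
    sumTo (g ℕ.* s ℕ.+ g) h                            ≈⟨ sumTo-+ (g ℕ.* s) g h ⟩
    sumTo (g ℕ.* s) h + sumTo g (λ i → h (g ℕ.* s ℕ.+ i))
      ≈⟨ +-cong (sumTo-multiples g s h g>0 h≈0) lastBlock ⟩
    sumTo s (λ k → h (g ℕ.* k)) + h (g ℕ.* s ℕ.+ g)
      ≡⟨ ≡.cong (λ n → sumTo s (λ k → h (g ℕ.* k)) + h n) g[1+s]≡gs+g ⟨
    sumTo s (λ k → h (g ℕ.* k)) + h (g ℕ.* suc s)
      ∎
    where
    g[1+s]≡gs+g : g ℕ.* suc s ≡ g ℕ.* s ℕ.+ g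
    g[1+s]≡gs+g = ≡.trans (ℕₚ.*-suc g s) (ℕₚ.+-comm g (g ℕ.* s))
    -- between consecutive multiples of g only the last index is a multiple of g
    lastBlock : sumTo g (λ i → h (g ℕ.* s ℕ.+ i)) ≈ h (g ℕ.* s ℕ.+ g)
    lastBlock = sumTo-single g _ g g>0 ℕₚ.≤-refl λ k 1≤k k≤g k≢g → h≈0 _ λ g∣gs+k →
      k≢g (ℕₚ.≤-antisym k≤g (∣⇒≤ {{>-nonZero 1≤k}} (∣m+n∣m⇒∣n g∣gs+k (m∣m*n s))))

  when : Bool → Carrier → Carrier
  when true  x = x
  when false _ = 0#

  when-yes : ∀ {p} {P : Set p} (P? : Dec P) → P → ∀ x → when (does P?) x ≈ x
  when-yes (yes _) _ x = refl
  when-yes (no ¬p) p x = contradiction p ¬p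

  when-no : ∀ {p} {P : Set p} (P? : Dec P) → ¬ P → ∀ x → when (does P?) x ≈ 0#
  when-no (yes p) ¬p x = contradiction p ¬p
  when-no (no _)  _  x = refl

  when-congᵈ : ∀ {p} {P : Set p} (P? : Dec P) {x y} → (P → x ≈ y) → when (does P?) x ≈ when (does P?) y
  when-congᵈ (yes p) x≈y = x≈y p
  when-congᵈ (no _)  _   = refl

  when-0# : ∀ b → when b 0# ≈ 0#
  when-0# true  = refl
  when-0# false = refl

  when-sumTo : ∀ b r f → when b (sumTo r f) ≈ sumTo r (λ t → when b (f t))
  when-sumTo true  r f = refl
  when-sumTo false r f = sym (sumTo-zero r _ (λ _ _ _ → refl))

  when-∣-lcm : ∀ r L j x y →
    when (does (r ∣? j)) x * when (does (L ∣? j)) y ≈ when (does (lcm r L ∣? j)) (x * y)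
  when-∣-lcm r L j x y with r ∣? j | L ∣? j | lcm r L ∣? j
  ... | yes _   | yes _   | yes _    = refl
  ... | yes r∣j | yes L∣j | no ∤j    = contradiction (lcm-least r∣j L∣j) ∤j
  ... | _       | no L∤j  | yes lcm∣j = contradiction (∣-trans (n∣lcm[m,n] r L) lcm∣j) L∤j
  ... | no r∤j  | _       | yes lcm∣j = contradiction (∣-trans (m∣lcm[m,n] r L) lcm∣j) r∤j
  ... | yes _   | no _    | no _     = zeroʳ x
  ... | no _    | _       | no _     = zeroˡ _

  sumL-++ : ∀ xs ys → sumL (xs ++ ys) ≈ sumL xs + sumL ys
  sumL-++ []       ys = sym (+-identityˡ _)
  sumL-++ (x ∷ xs) ys = trans (+-congˡ (sumL-++ xs ys)) (sym (+-assoc _ _ _))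

  sumL-cong : ∀ {A : Set} {f g : A → Carrier} xs → (∀ x → f x ≈ g x) → sumL (map f xs) ≈ sumL (map g xs)
  sumL-cong []       f≈g = refl
  sumL-cong (x ∷ xs) f≈g = +-cong (f≈g x) (sumL-cong xs f≈g)

  *-distribˡ-sumL : ∀ {A : Set} x (f : A → Carrier) xs → x * sumL (map f xs) ≈ sumL (map (λ a → x * f a) xs)
  *-distribˡ-sumL x f []       = zeroʳ x
  *-distribˡ-sumL x f (a ∷ xs) = trans (distribˡ x _ _) (+-congˡ (*-distribˡ-sumL x f xs))

  *-distribʳ-sumL : ∀ {A : Set} x (f : A → Carrier) xs → sumL (map f xs) * x ≈ sumL (map (λ a → f a * x) xs)
  *-distribʳ-sumL x f xs =
    trans (*-comm _ x) (trans (*-distribˡ-sumL x f xs) (sumL-cong xs λ a → *-comm x (f a)))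

  sumL-concatMap : ∀ {A B : Set} (f : B → Carrier) (g : A → List B) xs →
    sumL (map f (List.concatMap g xs)) ≈ sumL (map (λ x → sumL (map f (g x))) xs)
  sumL-concatMap f g []       = refl
  sumL-concatMap f g (x ∷ xs) = begin
    sumL (map f (g x ++ List.concatMap g xs))           ≡⟨ ≡.cong sumL (List.map-++ f (g x) _) ⟩
    sumL (map f (g x) ++ map f (List.concatMap g xs))   ≈⟨ sumL-++ (map f (g x)) _ ⟩
    sumL (map f (g x)) + sumL (map f (List.concatMap g xs))
      ≈⟨ +-congˡ (sumL-concatMap f g xs) ⟩
    sumL (map f (g x)) + sumL (map (λ x → sumL (map f (g x))) xs)
      ∎

  sumL-sumTo-comm : ∀ {A : Set} s (f : A → ℕ → Carrier) xs →
    sumL (map (λ x → sumTo s (f x)) xs) ≈ sumTo s (λ j → sumL (map (λ x → f x j) xs))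
  sumL-sumTo-comm s f []       = sym (sumTo-zero s _ (λ _ _ _ → refl))
  sumL-sumTo-comm s f (x ∷ xs) = trans (+-congˡ (sumL-sumTo-comm s f xs)) (sym (sumTo-distrib-+ s _ _))

  sumL-oneTo : ∀ f r → sumL (map f (oneTo r)) ≈ sumTo r f
  sumL-oneTo f zero    = refl
  sumL-oneTo f (suc r) = begin
    sumL (map f (oneTo (suc r)))                 ≡⟨ ≡.cong (sumL ∘ map f) oneTo[1+r] ⟩
    sumL (map f (oneTo r ++ suc r ∷ []))         ≡⟨ ≡.cong sumL (List.map-++ f (oneTo r) _) ⟩
    sumL (map f (oneTo r) ++ f (suc r) ∷ [])     ≈⟨ sumL-++ (map f (oneTo r)) _ ⟩
    sumL (map f (oneTo r)) + (f (suc r) + 0#)    ≈⟨ +-cong (sumL-oneTo f r) (+-identityʳ _) ⟩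
    sumTo r f + f (suc r)                        ∎
    where
    oneTo[1+r] : oneTo (suc r) ≡ oneTo r ++ suc r ∷ []
    oneTo[1+r] = ≡.trans (≡.cong (map suc) (≡.sym (List.upTo-∷ʳ r))) (List.map-++ suc (upTo r) _)

  sumL-filter : ∀ {p} {P : Pred ℕ p} (P? : Decidable P) (f : ℕ → Carrier) xs →
    sumL (map f (filter P? xs)) ≈ sumL (map (λ x → when (does (P? x)) (f x)) xs)
  sumL-filter P? f []       = refl
  sumL-filter P? f (x ∷ xs) with does (P? x)
  ... | true  = +-congˡ (sumL-filter P? f xs)
  ... | false = trans (sumL-filter P? f xs) (sym (+-identityˡ _))

  sumL-filter-oneTo : ∀ {p} {P : Pred ℕ p} (P? : Decidable P) (f : ℕ → Carrier) r →
    sumL (map f (filter P? (oneTo r))) ≈ sumTo r (λ x → when (does (P? x)) (f x))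
  sumL-filter-oneTo P? f r = trans (sumL-filter P? f (oneTo r)) (sumL-oneTo _ r)

  sumL-tuples : ∀ {n} (F : ℕ → Carrier) (dss : Vec (List ℕ) n) →
    sumL (map (λ ds → prodVR (Vec.map F ds)) (tuples dss)) ≈ prodVR (Vec.map (λ ds → sumL (map F ds)) dss)
  sumL-tuples F []         = +-identityʳ 1#
  sumL-tuples F (ds ∷ dss) = begin
    sumL (map Π (List.concatMap (λ d → map (d ∷_) (tuples dss)) ds)) ≈⟨ sumL-concatMap Π _ ds ⟩
    sumL (map (λ d → sumL (map Π (map (d ∷_) (tuples dss)))) ds)    ≈⟨ sumL-cong ds headTerm ⟩
    sumL (map (λ d → F d * rest) ds)                                ≈⟨ *-distribʳ-sumL rest F ds ⟨
    sumL (map F ds) * rest                                          ∎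
    where
    Π : ∀ {k} → Vec ℕ k → Carrier
    Π ts = prodVR (Vec.map F ts)
    rest : Carrier
    rest = prodVR (Vec.map (λ ds → sumL (map F ds)) dss)
    headTerm : ∀ d → sumL (map Π (map (d ∷_) (tuples dss))) ≈ F d * rest
    headTerm d = begin
      sumL (map Π (map (d ∷_) (tuples dss)))      ≡⟨ ≡.cong sumL (List.map-∘ (tuples dss)) ⟨
      sumL (map (λ ts → F d * Π ts) (tuples dss)) ≈⟨ *-distribˡ-sumL (F d) Π (tuples dss) ⟨
      F d * sumL (map Π (tuples dss))             ≈⟨ *-congˡ (sumL-tuples F dss) ⟩
      F d * rest                                  ∎

  geometricSum≈0 : (∀ x y → x * y ≈ 0# → x ≈ 0# ⊎ y ≈ 0#) →
    ∀ s ω → pow ω s ≈ 1# → ¬ ω ≈ 1# → sumTo s (pow ω) ≈ 0#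
  geometricSum≈0 noZeroDivisors s ω ωˢ≈1 ω≉1 with noZeroDivisors (ω - 1#) X [ω-1]X≈0
    where
    X : Carrier
    X = sumTo s (pow ω)
    -- multiplying by ω shifts the sum by one index, and ω^(s+1) = ω
    ωX≈X : ω * X ≈ X
    ωX≈X = +-cancelʳ ω (ω * X) X (begin
      ω * X + ω                              ≈⟨ +-comm _ ω ⟩
      ω + ω * X                              ≈⟨ +-cong (sym (*-identityʳ ω)) (*-distribˡ-sumTo s ω (pow ω)) ⟩
      ω * 1# + sumTo s (λ t → ω * pow ω t)   ≈⟨ sumTo-suc s (pow ω) ⟨
      sumTo (suc s) (pow ω)                  ≈⟨ +-congˡ (trans (*-congˡ ωˢ≈1) (*-identityʳ ω)) ⟩
      X + ω                                  ∎)
    [ω-1]X≈0 : (ω - 1#) * X ≈ 0#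
    [ω-1]X≈0 = trans ([y-z]x≈yx-zx X ω 1#) (x≈y⇒x∙y⁻¹≈ε (trans ωX≈X (sym (*-identityˡ X))))
  ... | inj₁ ω-1≈0 = contradiction (x∙y⁻¹≈ε⇒x≈y ω 1# ω-1≈0) ω≉1
  ... | inj₂ X≈0   = X≈0

  sumTo-byReducedDenom : ∀ {r} → 0 < r → (f : ℕ → Carrier) →
    sumTo r (λ d → when (does (d ∣? r)) (sumTo r (λ t → when (does (reducedDenom t r ℕₚ.≟ d)) (f t))))
      ≈ sumTo r f
  sumTo-byReducedDenom {r} r>0 f = begin
    sumTo r (λ d → when (does (d ∣? r)) (sumTo r (inFibre d)))
      ≈⟨ sumTo-cong r (λ d → when-sumTo (does (d ∣? r)) r (inFibre d)) ⟩
    sumTo r (λ d → sumTo r (term d))          ≈⟨ sumTo-comm r r term ⟩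
    sumTo r (λ t → sumTo r (λ d → term d t))  ≈⟨ sumTo-cong r ownDenominatorOnly ⟩
    sumTo r f                                 ∎
    where
    inFibre term : ℕ → ℕ → Carrier
    inFibre d t = when (does (reducedDenom t r ℕₚ.≟ d)) (f t)
    term d t = when (does (d ∣? r)) (inFibre d t)
    ownDenominatorOnly : ∀ t → sumTo r (λ d → term d t) ≈ f t
    ownDenominatorOnly t = begin
      sumTo r (λ d → term d t)
        ≈⟨ sumTo-single r _ d₀ (∣-positive r>0 d₀∣r) (reducedDenom≤ t r>0) otherDenominators ⟩
      when (does (d₀ ∣? r)) (inFibre d₀ t) ≈⟨ when-yes (d₀ ∣? r) d₀∣r _ ⟩
      inFibre d₀ t                         ≈⟨ when-yes (d₀ ℕₚ.≟ d₀) ≡.refl (f t) ⟩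
      f t                                  ∎
      where
      d₀ : ℕ
      d₀ = reducedDenom t r
      d₀∣r : d₀ ∣ r
      d₀∣r = reducedDenom∣ t r>0
      otherDenominators : ∀ d → 1 ≤ d → d ≤ r → d ≢ d₀ → term d t ≈ 0#
      otherDenominators d _ _ d≢d₀ =
        trans (when-congᵈ (d ∣? r) (λ _ → when-no (d₀ ℕₚ.≟ d) (d≢d₀ ∘ ≡.sym) (f t)))
              (when-0# (does (d ∣? r)))

  module _ (noZeroDivisors : ∀ x y → x * y ≈ 0# → x ≈ 0# ⊎ y ≈ 0#)
           (ζᵐ≈1 : pow ζ m ≈ 1#) (ζ-primitive : ∀ k → 0 < k → k < m → ¬ pow ζ k ≈ 1#) (m>0 : 0 < m) where

    private instance
      m≢0 : ℕ.NonZero m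
      m≢0 = >-nonZero m>0

    ζ^[q*m]≈1 : ∀ q → pow ζ (q ℕ.* m) ≈ 1#
    ζ^[q*m]≈1 zero    = refl
    ζ^[q*m]≈1 (suc q) = trans (pow-+ ζ m (q ℕ.* m)) (trans (*-cong ζᵐ≈1 (ζ^[q*m]≈1 q)) (*-identityˡ 1#))

    m∣k⇒ζᵏ≈1 : ∀ {k} → m ∣ k → pow ζ k ≈ 1#
    m∣k⇒ζᵏ≈1 (divides q ≡.refl) = ζ^[q*m]≈1 q

    ζᵏ≈1⇒m∣k : ∀ k → pow ζ k ≈ 1# → m ∣ k
    ζᵏ≈1⇒m∣k k ζᵏ≈1 with k % m ℕₚ.≟ 0
    ... | yes k%m≡0 = m%n≡0⇒n∣m k m k%m≡0
    ... | no  k%m≢0 = contradiction ζ^[k%m]≈1 (ζ-primitive (k % m) (ℕₚ.n≢0⇒n>0 k%m≢0) (m%n<n k m))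
      where
      ζ^[k%m]≈1 : pow ζ (k % m) ≈ 1#
      ζ^[k%m]≈1 = begin
        pow ζ (k % m)                         ≈⟨ *-identityʳ _ ⟨
        pow ζ (k % m) * 1#                    ≈⟨ *-congˡ (ζ^[q*m]≈1 (k / m)) ⟨
        pow ζ (k % m) * pow ζ (k / m ℕ.* m)   ≈⟨ pow-+ ζ (k % m) _ ⟨
        pow ζ (k % m ℕ.+ k / m ℕ.* m)         ≡⟨ ≡.cong (pow ζ) (m≡m%n+[m/n]*n k m) ⟨
        pow ζ k                               ≈⟨ ζᵏ≈1 ⟩
        1#                                    ∎

    ∣⇒e≈1 : ∀ {r x} → r ∣ m → 0 < r → r ∣ x → e x r ≈ 1#
    ∣⇒e≈1 {r} {x} r∣m r>0 r∣x =
      m∣k⇒ζᵏ≈1 (≡.subst (_∣ x ℕ.* quot m r) (*quot≡ r>0 r∣m) (*-monoˡ-∣ _ r∣x))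

    e≈1⇒∣ : ∀ {r} x → r ∣ m → 0 < r → e x r ≈ 1# → r ∣ x
    e≈1⇒∣ {r} x r∣m r>0 eˣ≈1 = *-cancelʳ-∣ (quot m r) {{>-nonZero (∣-positive m>0 (quot∣ r>0 r∣m))}}
      (≡.subst (_∣ x ℕ.* quot m r) (≡.sym (*quot≡ r>0 r∣m)) (ζᵏ≈1⇒m∣k _ eˣ≈1))

    orthogonality : ∀ {r} j → r ∣ m → 0 < r →
      sumTo r (λ t → e (t ℕ.* j) r) ≈ when (does (r ∣? j)) (cast r)
    orthogonality {r} j r∣m r>0 with r ∣? j
    ... | yes r∣j = trans (sumTo-cong r λ t → ∣⇒e≈1 r∣m r>0 (∣-trans r∣j (n∣m*n t))) (sumTo-const r)
    ... | no  r∤j = trans (sumTo-cong r e[tj/r]≈ωᵗ)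
                          (geometricSum≈0 noZeroDivisors r ω ωʳ≈1 (r∤j ∘ e≈1⇒∣ j r∣m r>0))
      where
      ω : Carrier
      ω = e j r
      rearrange : ∀ t j q → t ℕ.* j ℕ.* q ≡ j ℕ.* q ℕ.* t
      rearrange = solve-∀
      e[tj/r]≈ωᵗ : ∀ t → e (t ℕ.* j) r ≈ pow ω t
      e[tj/r]≈ωᵗ t = trans (reflexive (≡.cong (pow ζ) (rearrange t j (quot m r)))) (pow-* ζ (j ℕ.* quot m r) t)
      ωʳ≈1 : pow ω r ≈ 1#
      ωʳ≈1 = trans (sym (e[tj/r]≈ωᵗ r)) (∣⇒e≈1 r∣m r>0 (m∣m*n j))

    e-cancel : ∀ g {d} x → g ℕ.* d ∣ m → 0 < g ℕ.* d → e (g ℕ.* x) (g ℕ.* d) ≡ e x d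
    e-cancel g {d} x gd∣m gd>0 = ≡.cong (pow ζ) (≡.trans (rearrange g x q) (≡.cong (x ℕ.*_) (≡.sym quot[m,d])))
      where
      q : ℕ
      q = quot m (g ℕ.* d)
      rearrange : ∀ g x q → g ℕ.* x ℕ.* q ≡ x ℕ.* (q ℕ.* g)
      rearrange = solve-∀
      quot[m,d] : quot m d ≡ q ℕ.* g
      quot[m,d] = quot-exact (∣-positive gd>0 (n∣m*n g))
                    (≡.trans (≡.sym (quot*≡ gd>0 gd∣m)) (≡.sym (ℕₚ.*-assoc q g d)))

    -- t = g k with r = g d has reduced denominator d exactly when (k, d) = 1
    fibre : ∀ {r d} j → r ∣ m → 0 < r → d ∣ r →
      sumTo r (λ t → when (does (reducedDenom t r ℕₚ.≟ d)) (e (t ℕ.* j) r)) ≈ C d j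
    fibre {d = d} j gd∣m gd>0 (divides g ≡.refl) = begin
      sumTo (g ℕ.* d) h            ≈⟨ sumTo-multiples g d h g>0 offMultiples ⟩
      sumTo d (λ k → h (g ℕ.* k))  ≈⟨ sumTo-cong d onMultiples ⟩
      sumTo d (λ k → when (does (coprime? k d)) (e (k ℕ.* j) d))
        ≈⟨ sumL-filter-oneTo (λ k → coprime? k d) _ d ⟨
      C d j                        ∎
      where
      g>0 : 0 < g
      g>0 = ∣-positive gd>0 (m∣m*n d)
      d>0 : 0 < d
      d>0 = ∣-positive gd>0 (n∣m*n g)
      h : ℕ → Carrier
      h t = when (does (reducedDenom t (g ℕ.* d) ℕₚ.≟ d)) (e (t ℕ.* j) (g ℕ.* d))
      offMultiples : ∀ t → ¬ g ∣ t → h t ≈ 0#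
      offMultiples t g∤t = when-no (_ ℕₚ.≟ d) (g∤t ∘ reducedDenom≡⇒∣ t gd>0) _
      reducedDenom≡⇔coprime′ : ∀ k → reducedDenom (g ℕ.* k) (g ℕ.* d) ≡ d ⇔ Coprime k d
      reducedDenom≡⇔coprime′ k = ≡.subst (λ n → n ≡ d ⇔ Coprime k d) (≡.sym (reducedDenom-* g k g>0 d>0))
                                         (reducedDenom≡⇔coprime k d>0)
      onMultiples : ∀ k → h (g ℕ.* k) ≈ when (does (coprime? k d)) (e (k ℕ.* j) d)
      onMultiples k = reflexive (≡.cong₂ when
        (does-⇔ (reducedDenom≡⇔coprime′ k) (reducedDenom (g ℕ.* k) (g ℕ.* d) ℕₚ.≟ d) (coprime? k d))
        (≡.trans (≡.cong (λ n → e n (g ℕ.* d)) (ℕₚ.*-assoc g k j)) (e-cancel g (k ℕ.* j) gd∣m gd>0)))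

    divisorSum-C : ∀ {r} j → r ∣ m → 0 < r →
      sumL (map (λ d → C d j) (divisors r)) ≈ when (does (r ∣? j)) (cast r)
    divisorSum-C {r} j r∣m r>0 = begin
      sumL (map (λ d → C d j) (divisors r))
        ≈⟨ sumL-filter-oneTo (_∣? r) (λ d → C d j) r ⟩
      sumTo r (λ d → when (does (d ∣? r)) (C d j))
        ≈⟨ sumTo-cong r (λ d → when-congᵈ (d ∣? r) (sym ∘ fibre j r∣m r>0)) ⟩
      sumTo r (λ d → when (does (d ∣? r))
                     (sumTo r (λ t → when (does (reducedDenom t r ℕₚ.≟ d)) (e (t ℕ.* j) r))))
        ≈⟨ sumTo-byReducedDenom r>0 _ ⟩
      sumTo r (λ t → e (t ℕ.* j) r)
        ≈⟨ orthogonality j r∣m r>0 ⟩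
      when (does (r ∣? j)) (cast r)
        ∎

    prodVR-divisorSums-C : ∀ {n} (ms : Vec ℕ n) j → All (0 <_) ms → lcmV ms ∣ m →
      prodVR (Vec.map (λ ds → sumL (map (λ d → C d j) ds)) (Vec.map divisors ms))
        ≈ when (does (lcmV ms ∣? j)) (cast (prodV ms))
    prodVR-divisorSums-C []       j []         _     = sym (trans (when-yes (1 ∣? j) (1∣ j) _) (+-identityʳ 1#))
    prodVR-divisorSums-C (r ∷ rs) j (r>0 ∷ rs>0) lcm∣m = begin
      sumL (map (λ d → C d j) (divisors r))
        * prodVR (Vec.map (λ ds → sumL (map (λ d → C d j) ds)) (Vec.map divisors rs))
        ≈⟨ *-cong (divisorSum-C j (∣-trans (m∣lcm[m,n] r _) lcm∣m) r>0)
                  (prodVR-divisorSums-C rs j rs>0 (∣-trans (n∣lcm[m,n] r _) lcm∣m)) ⟩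
      when (does (r ∣? j)) (cast r) * when (does (lcmV rs ∣? j)) (cast (prodV rs))
        ≈⟨ when-∣-lcm r (lcmV rs) j (cast r) (cast (prodV rs)) ⟩
      when (does (lcm r (lcmV rs) ∣? j)) (cast r * cast (prodV rs))
        ≈⟨ when-congᵈ (lcm r (lcmV rs) ∣? j) (λ _ → sym (cast-* r (prodV rs))) ⟩
      when (does (lcm r (lcmV rs) ∣? j)) (cast (r ℕ.* prodV rs))
        ∎

    -- Only the multiples j = L t contribute, and e(bLt / m) = e(tb / (m/L)).
    average-indicator : ∀ {L} P b minv → L ∣ m → L ∣ P → cast m * minv ≈ 1# →
      minv * sumTo m (λ j → when (does (L ∣? j)) (cast P) * e (b ℕ.* j) m)
        ≈ when (does (quot m L ∣? b)) (cast (quot P L))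
    average-indicator {L} P b minv L∣m L∣P m·minv≈1 = begin
      minv * sumTo m h                                   ≡⟨ ≡.cong (λ n → minv * sumTo n h) (≡.sym L*M≡m) ⟩
      minv * sumTo (L ℕ.* M) h                           ≈⟨ *-congˡ (sumTo-multiples L M h L>0 offMultiples) ⟩
      minv * sumTo M (λ t → h (L ℕ.* t))                 ≈⟨ *-congˡ (sumTo-cong M onMultiples) ⟩
      minv * sumTo M (λ t → cast P * e (t ℕ.* b) M)      ≈⟨ *-congˡ (*-distribˡ-sumTo M (cast P) _) ⟨
      minv * (cast P * sumTo M (λ t → e (t ℕ.* b) M))    ≈⟨ *-congˡ (*-congˡ (orthogonality b M∣m M>0)) ⟩
      minv * (cast P * when (does (M ∣? b)) (cast M))    ≈⟨ normalise (M ∣? b) ⟩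
      when (does (M ∣? b)) (cast (quot P L))             ∎
      where
      M : ℕ
      M = quot m L
      L>0 : 0 < L
      L>0 = ∣-positive m>0 L∣m
      L*M≡m : L ℕ.* M ≡ m
      L*M≡m = *quot≡ L>0 L∣m
      M∣m : M ∣ m
      M∣m = quot∣ L>0 L∣m
      M>0 : 0 < M
      M>0 = ∣-positive m>0 M∣m
      h : ℕ → Carrier
      h j = when (does (L ∣? j)) (cast P) * e (b ℕ.* j) m
      offMultiples : ∀ t → ¬ L ∣ t → h t ≈ 0#
      offMultiples t L∤t = trans (*-congʳ (when-no (L ∣? t) L∤t _)) (zeroˡ _)
      rearrange : ∀ b L t → b ℕ.* (L ℕ.* t) ℕ.* 1 ≡ t ℕ.* b ℕ.* L
      rearrange = solve-∀
      exponent : ∀ t → b ℕ.* (L ℕ.* t) ℕ.* quot m m ≡ t ℕ.* b ℕ.* quot m M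
      exponent t = ≡.trans (≡.cong (b ℕ.* (L ℕ.* t) ℕ.*_) (quot-exact m>0 (≡.sym (ℕₚ.*-identityˡ m))))
                   (≡.trans (rearrange b L t) (≡.cong (t ℕ.* b ℕ.*_) (≡.sym (quot-exact M>0 (≡.sym L*M≡m)))))
      onMultiples : ∀ t → h (L ℕ.* t) ≈ cast P * e (t ℕ.* b) M
      onMultiples t = *-cong (when-yes (L ∣? L ℕ.* t) (m∣m*n t) _) (reflexive (≡.cong (pow ζ) (exponent t)))
      P*M≡P/L*m : P ℕ.* M ≡ quot P L ℕ.* m
      P*M≡P/L*m = ≡.trans (≡.cong (ℕ._* M) (≡.sym (quot*≡ L>0 L∣P)))
                    (≡.trans (ℕₚ.*-assoc (quot P L) L M) (≡.cong (quot P L ℕ.*_) L*M≡m))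
      normalise : (M∣?b : Dec (M ∣ b)) →
        minv * (cast P * when (does M∣?b) (cast M)) ≈ when (does M∣?b) (cast (quot P L))
      normalise (no _)  = trans (*-congˡ (zeroʳ _)) (zeroʳ _)
      normalise (yes _) = begin
        minv * (cast P * cast M)            ≈⟨ *-congˡ (cast-* P M) ⟨
        minv * cast (P ℕ.* M)               ≡⟨ ≡.cong (λ n → minv * cast n) P*M≡P/L*m ⟩
        minv * cast (quot P L ℕ.* m)        ≈⟨ *-congˡ (cast-* (quot P L) m) ⟩
        minv * (cast (quot P L) * cast m)   ≈⟨ *-comm _ _ ⟩
        (cast (quot P L) * cast m) * minv   ≈⟨ *-assoc _ _ _ ⟩
        cast (quot P L) * (cast m * minv)   ≈⟨ *-congˡ m·minv≈1 ⟩
        cast (quot P L) * 1#                ≈⟨ *-identityʳ _ ⟩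
        cast (quot P L)                     ∎

    J≡when : ∀ {n} b (ms : Vec ℕ n) →
      J b ms ≡ when (does (quot m (lcmV ms) ∣? b)) (cast (quot (prodV ms) (lcmV ms)))
    J≡when b ms with quot m (lcmV ms) ∣? b
    ... | yes _ = ≡.refl
    ... | no  _ = ≡.refl

    LHS≈J : ∀ {n} (ms : Vec ℕ n) b minv → All (0 <_) ms → lcmV ms ∣ m → cast m * minv ≈ 1# →
      LHS minv b ms ≈ J b ms
    LHS≈J ms b minv ms>0 L∣m m·minv≈1 = begin
      LHS minv b ms
        ≈⟨ sumL-cong Ts (λ ds → *-congˡ (sumL-oneTo _ m)) ⟩
      sumL (map (λ ds → minv * sumTo m (λ j → Π ds j * w j)) Ts)
        ≈⟨ *-distribˡ-sumL minv _ Ts ⟨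
      minv * sumL (map (λ ds → sumTo m (λ j → Π ds j * w j)) Ts)
        ≈⟨ *-congˡ (sumL-sumTo-comm m (λ ds j → Π ds j * w j) Ts) ⟩
      minv * sumTo m (λ j → sumL (map (λ ds → Π ds j * w j) Ts))
        ≈⟨ *-congˡ (sumTo-cong m λ j → *-distribʳ-sumL (w j) (λ ds → Π ds j) Ts) ⟨
      minv * sumTo m (λ j → sumL (map (λ ds → Π ds j) Ts) * w j)
        ≈⟨ *-congˡ (sumTo-cong m λ j → *-congʳ (trans (sumL-tuples (λ r → C r j) (Vec.map divisors ms))
                                                        (prodVR-divisorSums-C ms j ms>0 L∣m))) ⟩
      minv * sumTo m (λ j → when (does (lcmV ms ∣? j)) (cast (prodV ms)) * w j)
        ≈⟨ average-indicator (prodV ms) b minv L∣m (lcmV∣prodV ms) m·minv≈1 ⟩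
      when (does (quot m (lcmV ms) ∣? b)) (cast (quot (prodV ms) (lcmV ms)))
        ≡⟨ J≡when b ms ⟨
      J b ms
        ∎
      where
      Ts : List (Vec ℕ _)
      Ts = tuples (Vec.map divisors ms)
      Π : ∀ {k} → Vec ℕ k → ℕ → Carrier
      Π ds j = prodVR (Vec.map (λ r → C r j) ds)
      w : ℕ → Carrier
      w j = e (b ℕ.* j) m

lemma7 : ∀ {c ℓ : Level} (n : ℕ) (ms : Vec ℕ n) (b m : ℕ) →
    All (0 <_) ms → 0 < b → 0 < m → lcmV ms ∣ m →
    (R : CommutativeRing c ℓ) → (ζ minv : CommutativeRing.Carrier R) →
    let open CommutativeRing R
        open Cyclo R ζ m
    in (∀ x y → x * y ≈ 0# → x ≈ 0# ⊎ y ≈ 0#) →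
       (∀ k → cast k ≈ 0# → k ≡ 0) →
       pow ζ m ≈ 1# →
       (∀ k → 0 < k → k < m → ¬ (pow ζ k ≈ 1#)) →
       cast m * minv ≈ 1# →
       LHS minv b ms ≈ J b ms
lemma7 n ms b m ms>0 _ m>0 L∣m R ζ minv noZeroDivisors _ ζᵐ≈1 ζ-primitive m·minv≈1 =
  LHS≈J R ζ m noZeroDivisors ζᵐ≈1 ζ-primitive m>0 ms b minv ms>0 L∣m m·minv≈1
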